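{- Let $D=(V,A)$ be a finite digraph, $\mathcal S$ a finite set, $\pi:\mathcal S\to V$ a map, and $\mathcal M$ a matroid on $\mathcal S$ with rank function $r_{\mathcal M}$, and suppose $\rho_D(X)\ge r_{\mathcal M}(\mathcal S)-r_{\mathcal M}(\mathcal S_X)$ for all non-empty $X\subseteq V$. Let $X\subseteq V$ be a tight set and $v\in X$. Then: (a) if $Y$ is a tight set containing $v$, then $X\cap Y$ and $X\cup Y$ are tight and $r_{\mathcal M}(\mathcal S_X\cap\mathcal S_Y)+r_{\mathcal M}(\mathcal S_X\cup\mathcal S_Y)=r_{\mathcal M}(\mathcal S_X)+r_{\mathcal M}(\mathcal S_Y)$; (b) if $Y$ is the set of vertices of $X$ from which $v$ is reachable by a directed path in the induced subdigraph $D[X]$, then $v\in Y\subseteq X$, $Y$ is tight, and $Y$ dominates $X$; (c) if $Y$ is the set of vertices of $X$ from which $v$ is reachable by a directed path in $D[X]$ using only good arcs, then $v$ dominates $Y$.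
   Context: For $X\subseteq V$, $\mathcal S_X=\pi^{ -1}(X)$ and $\rho_D(X)$ is the number of arcs of $D$ entering $X$. For $Q\subseteq\mathcal S$, $\mathrm{Span}_{\mathcal M}(Q)=\{s\in\mathcal S: r_{\mathcal M}(Q\cup\{s\})=r_{\mathcal M}(Q)\}$. A vertex set $X$ is tight if $\rho_D(X)=r_{\mathcal M}(\mathcal S)-r_{\mathcal M}(\mathcal S_X)$. For vertex sets $X,Y$, $Y$ dominates $X$ if $\mathcal S_X\subseteq\mathrm{Span}_{\mathcal M}(\mathcal S_Y)$ (a single vertex $v$ is identified with $\{v\}$). An arc $uv$ is good if $v$ dominates $u$, i.e. $\pi^{ -1}(u)\subseteq\mathrm{Span}_{\mathcal M}(\pi^{ -1}(v))$, and bad otherwise. -}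

module Defs where

open import Data.Nat using (ℕ; zero; suc; _+_; _∸_; _≤_)
open import Data.Bool using (Bool; true; false; if_then_else_; _∧_; not)
open import Data.Fin using (Fin)
open import Data.Fin.Subset using (Subset; _∈_; _⊆_; _∩_; _∪_; ⁅_⁆; ⊤; ∣_∣; Nonempty)
open import Data.Vec using (lookup; tabulate)
open import Data.Product using (_×_; _,_)
open import Data.List using (List; []; _∷_)
import Data.List.Membership.Propositional as LM
open import Relation.Binary.PropositionalEquality using (_≡_)
import Data.Unit as Unit

record Matroid (m : ℕ) : Set where
  field
    rank      : Subset m → ℕ
    rank-bound : ∀ X → rank X ≤ ∣ X ∣
    rank-mono  : ∀ {X Y} → X ⊆ Y → rank X ≤ rank Y
    rank-submod : ∀ X Y → rank (X ∩ Y) + rank (X ∪ Y) ≤ rank X + rank Y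
open Matroid public

-- A finite digraph on vertex set Fin n: a list of arcs (u , v) = arc from u to v
-- (parallel arcs allowed).
Digraph : ℕ → Set
Digraph n = List (Fin n × Fin n)

preimage : ∀ {m n} → (Fin m → Fin n) → Subset n → Subset m
preimage π X = tabulate (λ s → lookup X (π s))

ρ : ∀ {n} → Digraph n → Subset n → ℕ
ρ [] X = 0
ρ ((u , v) ∷ as) X = (if lookup X v ∧ not (lookup X u) then 1 else 0) + ρ as X

Tight : ∀ {m n} → Digraph n → (Fin m → Fin n) → Matroid m → Subset n → Set
Tight D π M X = ρ D X ≡ rank M ⊤ ∸ rank M (preimage π X)

InSpan : ∀ {m} → Matroid m → Subset m → Fin m → Set
InSpan M Q s = rank M (Q ∪ ⁅ s ⁆) ≡ rank M Q

Dominates : ∀ {m n} → (Fin m → Fin n) → Matroid m → Subset n → Subset n → Set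
Dominates π M Y X = ∀ s → s ∈ preimage π X → InSpan M (preimage π Y) s

Good : ∀ {m n} → (Fin m → Fin n) → Matroid m → Fin n → Fin n → Set
Good π M u v = Dominates π M ⁅ v ⁆ ⁅ u ⁆

data Walk {n} (D : Digraph n) (X : Subset n) (ok : Fin n → Fin n → Set)
     : Fin n → Fin n → Set where
  here : ∀ {u} → u ∈ X → Walk D X ok u u
  step : ∀ {u w v} → u ∈ X → (u , w) LM.∈ D → ok u w → Walk D X ok w v → Walk D X ok u v

AnyArc : ∀ {n} → Fin n → Fin n → Set
AnyArc _ _ = Unit.⊤

-- Write r+ρ(Z) = r(S_Z) + ρ(Z).  Tightness says r+ρ attains its lower bound r(S), and
-- r+ρ is submodular because both r ∘ π⁻¹ and ρ are.  For tight X, Y sharing v the values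
-- at X ∩ Y and X ∪ Y are each at least r(S) but sum to at most 2 r(S), so all the
-- submodular inequalities are equalities.  If Y ⊆ X is the set of vertices reaching v in
-- D[X], no arc of D[X] enters Y, so ρ(Y) ≤ ρ(X) and r(S_Y) ≤ r(S_X); the lower bound at Y
-- forces equality, and r(S_Y) = r(S_X) with S_Y ⊆ S_X means S_Y spans S_X.  Domination is
-- the closure relation of the matroid on preimages, hence transitive along good walks.
module Submission where

open import Defs
open import Data.Bool using (Bool; true; false; _∧_; _∨_; not; if_then_else_)
open import Data.Fin using (Fin)
open import Data.Fin.Subset using (Subset; _∈_; _⊆_; _∩_; _∪_; ⊤; ⁅_⁆; ⋃; Nonempty)
open import Data.Fin.Subset.Properties
  using ( x∈p∪q⁻; x∈p∪q⁺; x∈p∩q⁺; p∩q⊆p; p⊆p∪q; q⊆p∪q; x∈⁅x⁆; x∈⁅y⁆⇒x≡y; _∈?_; ∈⊤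
        ; ⊆-refl; ⊆-min; ∪-assoc)
open import Data.List using (List; []; _∷_; map; filter; allFin)
import Data.List.Membership.Propositional as List
open import Data.List.Membership.Propositional.Properties using (∈-allFin; ∈-filter⁺; ∈-filter⁻)
open import Data.List.Relation.Unary.Any using (here; there)
open import Data.Nat using (ℕ; _+_; _∸_; _≤_; _≥_; z≤n)
open import Data.Nat.Properties
open import Algebra.Properties.CommutativeSemigroup +-commutativeSemigroup using (interchange)
open import Data.Product using (_×_; _,_; proj₁; proj₂)
open import Data.Sum using (inj₁; inj₂)
open import Data.Vec using (lookup; tabulate; zipWith)
open import Data.Vec.Properties
  using ([]=⇒lookup; lookup⇒[]=; lookup∘tabulate; lookup-zipWith; tabulate-cong; tabulate∘lookup)
open import Function.Base using (_∘_)
open import Function.Bundles using (_⇔_; Equivalence; mk⇔)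
open import Relation.Binary.PropositionalEquality
  using (_≡_; refl; sym; trans; cong; cong₂; subst; module ≡-Reasoning)

m≤n∧o≤p∧n+p≤m+o⇒m≡n×o≡p : ∀ {m n o p} → m ≤ n → o ≤ p → n + p ≤ m + o → m ≡ n × o ≡ p
m≤n∧o≤p∧n+p≤m+o⇒m≡n×o≡p {m} {n} {o} {p} m≤n o≤p n+p≤m+o =
  ≤-antisym m≤n (+-cancelʳ-≤ p n m (≤-trans n+p≤m+o (+-monoʳ-≤ m o≤p))) ,
  ≤-antisym o≤p (+-cancelˡ-≤ n p o (≤-trans n+p≤m+o (+-monoˡ-≤ o m≤n)))

∪-⊆ : ∀ {n} {p q r : Subset n} → p ⊆ r → q ⊆ r → p ∪ q ⊆ r
∪-⊆ {p = p} {q} p⊆r q⊆r x∈p∪q with x∈p∪q⁻ p q x∈p∪q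
... | inj₁ x∈p = p⊆r x∈p
... | inj₂ x∈q = q⊆r x∈q

x∈p⇒⁅x⁆⊆p : ∀ {n} {p : Subset n} {x} → x ∈ p → ⁅ x ⁆ ⊆ p
x∈p⇒⁅x⁆⊆p {p = p} {x} x∈p y∈⁅x⁆ = subst (_∈ p) (sym (x∈⁅y⁆⇒x≡y x y∈⁅x⁆)) x∈p

∈-⋃-singletons : ∀ {n} {x : Fin n} {xs} → x List.∈ xs → x ∈ ⋃ (map ⁅_⁆ xs)
∈-⋃-singletons {x = x} (here refl) = x∈p∪q⁺ (inj₁ (x∈⁅x⁆ x))
∈-⋃-singletons (there x∈xs)       = x∈p∪q⁺ (inj₂ (∈-⋃-singletons x∈xs))

module _ {m n} (π : Fin m → Fin n) where

  ∈-preimage⁺ : ∀ {X s} → π s ∈ X → s ∈ preimage π X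
  ∈-preimage⁺ {X} {s} πs∈X =
    lookup⇒[]= s _ (trans (lookup∘tabulate (λ t → lookup X (π t)) s) ([]=⇒lookup πs∈X))

  ∈-preimage⁻ : ∀ {X s} → s ∈ preimage π X → π s ∈ X
  ∈-preimage⁻ {X} {s} s∈S_X =
    lookup⇒[]= (π s) X (trans (sym (lookup∘tabulate (λ t → lookup X (π t)) s)) ([]=⇒lookup s∈S_X))

  preimage-mono : ∀ {X Y} → X ⊆ Y → preimage π X ⊆ preimage π Y
  preimage-mono X⊆Y s∈S_X = ∈-preimage⁺ (X⊆Y (∈-preimage⁻ s∈S_X))

  preimage-zipWith : ∀ (f : Bool → Bool → Bool) X Y →
    preimage π (zipWith f X Y) ≡ zipWith f (preimage π X) (preimage π Y)
  preimage-zipWith f X Y = begin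
    tabulate (λ s → lookup (zipWith f X Y) (π s))
      ≡⟨ tabulate-cong (λ s → lookup-zipWith f (π s) X Y) ⟩
    tabulate (λ s → f (lookup X (π s)) (lookup Y (π s)))
      ≡⟨ tabulate-cong (λ s → sym (trans (lookup-zipWith f s (preimage π X) (preimage π Y))
           (cong₂ f (lookup∘tabulate (lookup X ∘ π) s) (lookup∘tabulate (lookup Y ∘ π) s)))) ⟩
    tabulate (lookup (zipWith f (preimage π X) (preimage π Y)))
      ≡⟨ tabulate∘lookup _ ⟩
    zipWith f (preimage π X) (preimage π Y) ∎
    where open ≡-Reasoning

-- ρ (a ∷ D) X unfolds definitionally to entering X a + ρ D X.
entering : ∀ {n} → Subset n → Fin n × Fin n → ℕ
entering X (u , v) = if lookup X v ∧ not (lookup X u) then 1 else 0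

entering-∩-∪ : ∀ xv xu yv yu →
  (if (xv ∧ yv) ∧ not (xu ∧ yu) then 1 else 0) + (if (xv ∨ yv) ∧ not (xu ∨ yu) then 1 else 0)
    ≤ (if xv ∧ not xu then 1 else 0) + (if yv ∧ not yu then 1 else 0)
entering-∩-∪ false _     false _     = z≤n
entering-∩-∪ true  true  true  yu    = ≤-reflexive (+-identityʳ _)
entering-∩-∪ true  false true  true  = ≤-refl
entering-∩-∪ true  false true  false = ≤-refl
entering-∩-∪ true  true  false _     = z≤n
entering-∩-∪ true  false false true  = z≤n
entering-∩-∪ true  false false false = ≤-refl
entering-∩-∪ false true  true  yu    = z≤n
entering-∩-∪ false false true  true  = z≤n
entering-∩-∪ false false true  false = ≤-refl

entering-submodular : ∀ {n} (X Y : Subset n) a →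
  entering (X ∩ Y) a + entering (X ∪ Y) a ≤ entering X a + entering Y a
entering-submodular X Y (u , v)
  rewrite lookup-zipWith _∧_ v X Y | lookup-zipWith _∧_ u X Y
        | lookup-zipWith _∨_ v X Y | lookup-zipWith _∨_ u X Y
  = entering-∩-∪ (lookup X v) (lookup X u) (lookup Y v) (lookup Y u)

entering-mono : ∀ {n} {X Y : Subset n} {u w} → Y ⊆ X → (u ∈ X → w ∈ Y → u ∈ Y) →
  entering Y (u , w) ≤ entering X (u , w)
entering-mono {X = X} {Y} {u} {w} Y⊆X closed with lookup Y w in w∈Y | lookup Y u in u∈Y
... | false | _    = z≤n
... | true  | true = z≤n
... | true  | false rewrite []=⇒lookup (Y⊆X (lookup⇒[]= w Y w∈Y)) with lookup X u in u∈X
...   | false = ≤-refl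
...   | true with () ← trans (sym u∈Y) ([]=⇒lookup (closed (lookup⇒[]= u X u∈X) (lookup⇒[]= w Y w∈Y)))

ρ-submodular : ∀ {n} (D : Digraph n) X Y → ρ D (X ∩ Y) + ρ D (X ∪ Y) ≤ ρ D X + ρ D Y
ρ-submodular []      X Y = z≤n
ρ-submodular (a ∷ D) X Y = begin
  (entering (X ∩ Y) a + ρ D (X ∩ Y)) + (entering (X ∪ Y) a + ρ D (X ∪ Y))
    ≡⟨ interchange (entering (X ∩ Y) a) _ _ _ ⟩
  (entering (X ∩ Y) a + entering (X ∪ Y) a) + (ρ D (X ∩ Y) + ρ D (X ∪ Y))
    ≤⟨ +-mono-≤ (entering-submodular X Y a) (ρ-submodular D X Y) ⟩
  (entering X a + entering Y a) + (ρ D X + ρ D Y)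
    ≡⟨ interchange (entering X a) _ _ _ ⟩
  (entering X a + ρ D X) + (entering Y a + ρ D Y) ∎
  where open ≤-Reasoning

ρ-mono : ∀ {n} (D : Digraph n) {X Y} →
  (∀ {a} → a List.∈ D → entering Y a ≤ entering X a) → ρ D Y ≤ ρ D X
ρ-mono []      _  = z≤n
ρ-mono (a ∷ D) le = +-mono-≤ (le (here refl)) (ρ-mono D (le ∘ there))

-- In matroid terms: C lies in the closure of A.
Spans : ∀ {m} → Matroid m → Subset m → Subset m → Set
Spans M A C = rank M (A ∪ C) ≤ rank M A

module _ {m} (M : Matroid m) where

  ⊆⇒spans : ∀ {A C} → C ⊆ A → Spans M A C
  ⊆⇒spans C⊆A = rank-mono M (∪-⊆ ⊆-refl C⊆A)

  spans-antimono : ∀ {A C F} → C ⊆ F → Spans M A F → Spans M A C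
  spans-antimono {A} C⊆F A▹F = ≤-trans (rank-mono M (∪-⊆ (p⊆p∪q _) (q⊆p∪q A _ ∘ C⊆F))) A▹F

  spans-mono : ∀ {A B C} → A ⊆ B → Spans M A C → Spans M B C
  spans-mono {A} {B} {C} A⊆B A▹C = +-cancelˡ-≤ (rank M A) _ _ (begin
    rank M A + rank M (B ∪ C)
      ≤⟨ +-mono-≤ (rank-mono M (λ x∈A → x∈p∩q⁺ (A⊆B x∈A , p⊆p∪q C x∈A)))
                  (rank-mono M (∪-⊆ (p⊆p∪q _) (q⊆p∪q B _ ∘ q⊆p∪q A C))) ⟩
    rank M (B ∩ (A ∪ C)) + rank M (B ∪ (A ∪ C))
      ≤⟨ rank-submod M B (A ∪ C) ⟩
    rank M B + rank M (A ∪ C)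
      ≤⟨ +-monoʳ-≤ (rank M B) A▹C ⟩
    rank M B + rank M A
      ≡⟨ +-comm (rank M B) (rank M A) ⟩
    rank M A + rank M B ∎)
    where open ≤-Reasoning

  spans-∪ : ∀ {A C F} → Spans M A C → Spans M A F → Spans M A (C ∪ F)
  spans-∪ {A} {C} {F} A▹C A▹F = begin
    rank M (A ∪ (C ∪ F)) ≡⟨ cong (rank M) (sym (∪-assoc A C F)) ⟩
    rank M ((A ∪ C) ∪ F) ≤⟨ spans-mono (p⊆p∪q C) A▹F ⟩
    rank M (A ∪ C)       ≤⟨ A▹C ⟩
    rank M A             ∎
    where open ≤-Reasoning

  spans-trans : ∀ {A B C} → Spans M A B → Spans M B C → Spans M A C
  spans-trans {A} {B} {C} A▹B B▹C = begin
    rank M (A ∪ C)       ≤⟨ rank-mono M (∪-⊆ (p⊆p∪q C ∘ p⊆p∪q B) (q⊆p∪q (A ∪ B) C)) ⟩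
    rank M ((A ∪ B) ∪ C) ≤⟨ spans-mono (q⊆p∪q A B) B▹C ⟩
    rank M (A ∪ B)       ≤⟨ A▹B ⟩
    rank M A             ∎
    where open ≤-Reasoning

  spans-⋃-singletons : ∀ {A} xs → (∀ {x} → x List.∈ xs → Spans M A ⁅ x ⁆) →
    Spans M A (⋃ (map ⁅_⁆ xs))
  spans-⋃-singletons []       _    = ⊆⇒spans (⊆-min _)
  spans-⋃-singletons (x ∷ xs) A▹xs = spans-∪ (A▹xs (here refl)) (spans-⋃-singletons xs (A▹xs ∘ there))

  spans-pointwise : ∀ {A C} → (∀ {x} → x ∈ C → Spans M A ⁅ x ⁆) → Spans M A C
  spans-pointwise {A} {C} A▹C =
    spans-antimono C⊆⋃ (spans-⋃-singletons elems (A▹C ∘ proj₂ ∘ ∈-filter⁻ (_∈? C) {xs = allFin m}))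
    where
    elems : List (Fin m)
    elems = filter (_∈? C) (allFin m)
    C⊆⋃ : C ⊆ ⋃ (map ⁅_⁆ elems)
    C⊆⋃ {x} x∈C = ∈-⋃-singletons (∈-filter⁺ (_∈? C) (∈-allFin x) x∈C)

  inSpan⇔spans : ∀ {A x} → InSpan M A x ⇔ Spans M A ⁅ x ⁆
  inSpan⇔spans {A} = mk⇔ ≤-reflexive (λ A▹x → ≤-antisym A▹x (rank-mono M (p⊆p∪q _)))

  ⊆∧rank≡⇒spans : ∀ {A C} → A ⊆ C → rank M A ≡ rank M C → Spans M A C
  ⊆∧rank≡⇒spans A⊆C rA≡rC = ≤-trans (rank-mono M (∪-⊆ A⊆C ⊆-refl)) (≤-reflexive (sym rA≡rC))

walk-start : ∀ {n} {D : Digraph n} {X ok u v} → Walk D X ok u v → u ∈ X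
walk-start (here u∈X)       = u∈X
walk-start (step u∈X _ _ _) = u∈X

module _ {m n} (π : Fin m → Fin n) (M : Matroid m) where

  dominates⇔spans : ∀ Y X → Dominates π M Y X ⇔ Spans M (preimage π Y) (preimage π X)
  dominates⇔spans Y X = mk⇔
    (λ Y▸X → spans-pointwise M (λ {s} s∈S_X → Equivalence.to (inSpan⇔spans M) (Y▸X s s∈S_X)))
    (λ S_Y▹S_X s s∈S_X →
       Equivalence.from (inSpan⇔spans M) (spans-antimono M (x∈p⇒⁅x⁆⊆p s∈S_X) S_Y▹S_X))

  dominates-refl : ∀ {X} → Dominates π M X X
  dominates-refl {X} = Equivalence.from (dominates⇔spans X X) (⊆⇒spans M ⊆-refl)

  dominates-trans : ∀ {Z Y X} → Dominates π M Z Y → Dominates π M Y X → Dominates π M Z X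
  dominates-trans {Z} {Y} {X} Z▸Y Y▸X = Equivalence.from (dominates⇔spans Z X)
    (spans-trans M (Equivalence.to (dominates⇔spans Z Y) Z▸Y) (Equivalence.to (dominates⇔spans Y X) Y▸X))

  goodWalk⇒dominates : ∀ {D : Digraph n} {X u v} → Walk D X (Good π M) u v → Dominates π M ⁅ v ⁆ ⁅ u ⁆
  goodWalk⇒dominates {u = u} (here _)             = dominates-refl {⁅ u ⁆}
  goodWalk⇒dominates {v = v} (step {u} {w} _ _ good walk) =
    dominates-trans {⁅ v ⁆} {⁅ w ⁆} {⁅ u ⁆} (goodWalk⇒dominates walk) good

  goodReaching-dominated : ∀ {D : Digraph n} {X Y v} → (∀ u → u ∈ Y ⇔ Walk D X (Good π M) u v) →
    Dominates π M ⁅ v ⁆ Y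
  goodReaching-dominated {Y = Y} Y⇔walk s s∈S_Y =
    goodWalk⇒dominates (Equivalence.to (Y⇔walk (π s)) (∈-preimage⁻ π s∈S_Y))
      s (∈-preimage⁺ π (x∈⁅x⁆ (π s)))

module _ {m n} (D : Digraph n) (π : Fin m → Fin n) (M : Matroid m) where

  r+ρ : Subset n → ℕ
  r+ρ Z = rank M (preimage π Z) + ρ D Z

  rank-preimage≤rank⊤ : ∀ Z → rank M (preimage π Z) ≤ rank M ⊤
  rank-preimage≤rank⊤ Z = rank-mono M (λ _ → ∈⊤)

  -- Tightness without truncated subtraction.
  tight⇔r+ρ≡rank⊤ : ∀ Z → Tight D π M Z ⇔ r+ρ Z ≡ rank M ⊤
  tight⇔r+ρ≡rank⊤ Z = mk⇔
    (λ tight → trans (cong (rank M (preimage π Z) +_) tight) (m+[n∸m]≡n (rank-preimage≤rank⊤ Z)))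
    (λ r+ρ≡ → trans (sym (m+n∸m≡n (rank M (preimage π Z)) (ρ D Z)))
                    (cong (_∸ rank M (preimage π Z)) r+ρ≡))

  rank⊤≤r+ρ : ∀ Z → ρ D Z ≥ rank M ⊤ ∸ rank M (preimage π Z) → rank M ⊤ ≤ r+ρ Z
  rank⊤≤r+ρ Z ρ≥ =
    ≤-trans (m≤n+m∸n (rank M ⊤) (rank M (preimage π Z))) (+-monoʳ-≤ (rank M (preimage π Z)) ρ≥)

  rank-preimage-∩-∪ : ∀ X Y → rank M (preimage π (X ∩ Y)) + rank M (preimage π (X ∪ Y))
    ≡ rank M (preimage π X ∩ preimage π Y) + rank M (preimage π X ∪ preimage π Y)
  rank-preimage-∩-∪ X Y = cong₂ _+_ (cong (rank M) (preimage-zipWith π _∧_ X Y))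
                                   (cong (rank M) (preimage-zipWith π _∨_ X Y))

  rank-preimage-submodular : ∀ X Y → rank M (preimage π (X ∩ Y)) + rank M (preimage π (X ∪ Y))
    ≤ rank M (preimage π X) + rank M (preimage π Y)
  rank-preimage-submodular X Y =
    ≤-trans (≤-reflexive (rank-preimage-∩-∪ X Y)) (rank-submod M (preimage π X) (preimage π Y))

  r+ρ-submodular : ∀ X Y → r+ρ (X ∩ Y) + r+ρ (X ∪ Y) ≤ r+ρ X + r+ρ Y
  r+ρ-submodular X Y = begin
    r+ρ (X ∩ Y) + r+ρ (X ∪ Y)
      ≡⟨ interchange (rank M (preimage π (X ∩ Y))) _ _ _ ⟩
    (rank M (preimage π (X ∩ Y)) + rank M (preimage π (X ∪ Y))) + (ρ D (X ∩ Y) + ρ D (X ∪ Y))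
      ≤⟨ +-mono-≤ (rank-preimage-submodular X Y) (ρ-submodular D X Y) ⟩
    (rank M (preimage π X) + rank M (preimage π Y)) + (ρ D X + ρ D Y)
      ≡⟨ interchange (rank M (preimage π X)) _ _ _ ⟩
    r+ρ X + r+ρ Y ∎
    where open ≤-Reasoning

  -- Both summands of r+ρ are submodular, so equality for r+ρ forces equality for the rank.
  r+ρ-modular⇒rank-modular : ∀ X Y → r+ρ X + r+ρ Y ≤ r+ρ (X ∩ Y) + r+ρ (X ∪ Y) →
    rank M (preimage π X ∩ preimage π Y) + rank M (preimage π X ∪ preimage π Y)
      ≡ rank M (preimage π X) + rank M (preimage π Y)
  r+ρ-modular⇒rank-modular X Y r+ρ-sup = trans (sym (rank-preimage-∩-∪ X Y)) (proj₁
    (m≤n∧o≤p∧n+p≤m+o⇒m≡n×o≡p (rank-preimage-submodular X Y) (ρ-submodular D X Y) (begin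
      (rX + rY) + (ρ D X + ρ D Y)               ≡⟨ interchange rX rY (ρ D X) (ρ D Y) ⟩
      r+ρ X + r+ρ Y                             ≤⟨ r+ρ-sup ⟩
      r+ρ (X ∩ Y) + r+ρ (X ∪ Y)                 ≡⟨ interchange r∩ (ρ D (X ∩ Y)) r∪ (ρ D (X ∪ Y)) ⟩
      (r∩ + r∪) + (ρ D (X ∩ Y) + ρ D (X ∪ Y))  ∎)))
    where
    open ≤-Reasoning
    rX rY r∩ r∪ : ℕ
    rX = rank M (preimage π X)
    rY = rank M (preimage π Y)
    r∩ = rank M (preimage π (X ∩ Y))
    r∪ = rank M (preimage π (X ∪ Y))

  module _ (covering : ∀ Z → Nonempty Z → ρ D Z ≥ rank M ⊤ ∸ rank M (preimage π Z)) where

    tight-∩-∪ : ∀ {X Y} → Tight D π M X → Tight D π M Y → Nonempty (X ∩ Y) →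
      Tight D π M (X ∩ Y) × Tight D π M (X ∪ Y) ×
      (rank M (preimage π X ∩ preimage π Y) + rank M (preimage π X ∪ preimage π Y)
        ≡ rank M (preimage π X) + rank M (preimage π Y))
    tight-∩-∪ {X} {Y} tight-X tight-Y (x , x∈X∩Y) =
      Equivalence.from (tight⇔r+ρ≡rank⊤ (X ∩ Y)) (sym (proj₁ R≡r+ρ∩×R≡r+ρ∪)) ,
      Equivalence.from (tight⇔r+ρ≡rank⊤ (X ∪ Y)) (sym (proj₂ R≡r+ρ∩×R≡r+ρ∪)) ,
      r+ρ-modular⇒rank-modular X Y (begin
        r+ρ X + r+ρ Y             ≡⟨ R+R≡r+ρX+r+ρY ⟨
        rank M ⊤ + rank M ⊤       ≡⟨ cong₂ _+_ (proj₁ R≡r+ρ∩×R≡r+ρ∪) (proj₂ R≡r+ρ∩×R≡r+ρ∪) ⟩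
        r+ρ (X ∩ Y) + r+ρ (X ∪ Y) ∎)
      where
      open ≤-Reasoning
      R+R≡r+ρX+r+ρY : rank M ⊤ + rank M ⊤ ≡ r+ρ X + r+ρ Y
      R+R≡r+ρX+r+ρY = sym (cong₂ _+_ (Equivalence.to (tight⇔r+ρ≡rank⊤ X) tight-X)
                                     (Equivalence.to (tight⇔r+ρ≡rank⊤ Y) tight-Y))
      x∈X∪Y : x ∈ X ∪ Y
      x∈X∪Y = x∈p∪q⁺ (inj₁ (p∩q⊆p X Y x∈X∩Y))
      R≡r+ρ∩×R≡r+ρ∪ : rank M ⊤ ≡ r+ρ (X ∩ Y) × rank M ⊤ ≡ r+ρ (X ∪ Y)
      R≡r+ρ∩×R≡r+ρ∪ = m≤n∧o≤p∧n+p≤m+o⇒m≡n×o≡p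
        (rank⊤≤r+ρ (X ∩ Y) (covering (X ∩ Y) (x , x∈X∩Y)))
        (rank⊤≤r+ρ (X ∪ Y) (covering (X ∪ Y) (x , x∈X∪Y)))
        (≤-trans (r+ρ-submodular X Y) (≤-reflexive (sym R+R≡r+ρX+r+ρY)))

    tight-closed : ∀ {X Y} → Tight D π M X → Y ⊆ X → Nonempty Y →
      (∀ {u w} → (u , w) List.∈ D → u ∈ X → w ∈ Y → u ∈ Y) →
      Tight D π M Y × rank M (preimage π Y) ≡ rank M (preimage π X)
    tight-closed {X} {Y} tight-X Y⊆X nonempty-Y closed =
      Equivalence.from (tight⇔r+ρ≡rank⊤ Y)
        (trans r+ρY≡r+ρX (Equivalence.to (tight⇔r+ρ≡rank⊤ X) tight-X)) ,
      proj₁ rY≡rX×ρY≡ρX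
      where
      rY≡rX×ρY≡ρX : rank M (preimage π Y) ≡ rank M (preimage π X) × ρ D Y ≡ ρ D X
      rY≡rX×ρY≡ρX = m≤n∧o≤p∧n+p≤m+o⇒m≡n×o≡p
        (rank-mono M (preimage-mono π Y⊆X))
        (ρ-mono D (λ arc → entering-mono Y⊆X (closed arc)))
        (≤-trans (≤-reflexive (Equivalence.to (tight⇔r+ρ≡rank⊤ X) tight-X))
                 (rank⊤≤r+ρ Y (covering Y nonempty-Y)))
      r+ρY≡r+ρX : r+ρ Y ≡ r+ρ X
      r+ρY≡r+ρX = cong₂ _+_ (proj₁ rY≡rX×ρY≡ρX) (proj₂ rY≡rX×ρY≡ρX)

    reaching-tight : ∀ {X Y v} → Tight D π M X → v ∈ X → (∀ u → u ∈ Y ⇔ Walk D X AnyArc u v) →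
      v ∈ Y × Y ⊆ X × Tight D π M Y × Dominates π M Y X
    reaching-tight {X} {Y} {v} tight-X v∈X Y⇔walk =
      v∈Y , Y⊆X , proj₁ tight-Y×rY≡rX ,
      Equivalence.from (dominates⇔spans π M Y X)
        (⊆∧rank≡⇒spans M (preimage-mono π Y⊆X) (proj₂ tight-Y×rY≡rX))
      where
      walk : ∀ {u} → u ∈ Y → Walk D X AnyArc u v
      walk {u} = Equivalence.to (Y⇔walk u)
      unwalk : ∀ {u} → Walk D X AnyArc u v → u ∈ Y
      unwalk {u} = Equivalence.from (Y⇔walk u)
      v∈Y : v ∈ Y
      v∈Y = unwalk (here v∈X)
      Y⊆X : Y ⊆ X
      Y⊆X = walk-start ∘ walk
      tight-Y×rY≡rX : Tight D π M Y × rank M (preimage π Y) ≡ rank M (preimage π X)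
      tight-Y×rY≡rX = tight-closed tight-X Y⊆X (v , v∈Y)
        (λ arc u∈X w∈Y → unwalk (step u∈X arc _ (walk w∈Y)))

mainTheorem4 : ∀ {n m} (D : Digraph n) (π : Fin m → Fin n) (M : Matroid m) →
    (∀ (X : Subset n) → Nonempty X → ρ D X ≥ rank M ⊤ ∸ rank M (preimage π X)) →
    ∀ (X : Subset n) (v : Fin n) → Tight D π M X → v ∈ X →
      (∀ (Y : Subset n) → Tight D π M Y → v ∈ Y →
         Tight D π M (X ∩ Y) × Tight D π M (X ∪ Y) ×
         (rank M (preimage π X ∩ preimage π Y) + rank M (preimage π X ∪ preimage π Y)
           ≡ rank M (preimage π X) + rank M (preimage π Y)))
      × (∀ (Y : Subset n) → (∀ u → u ∈ Y ⇔ Walk D X AnyArc u v) →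
           v ∈ Y × Y ⊆ X × Tight D π M Y × Dominates π M Y X)
      × (∀ (Y : Subset n) → (∀ u → u ∈ Y ⇔ Walk D X (Good π M) u v) →
           Dominates π M (⁅ v ⁆) Y)
mainTheorem4 D π M covering X v tight-X v∈X =
  (λ Y tight-Y v∈Y → tight-∩-∪ D π M covering tight-X tight-Y (v , x∈p∩q⁺ (v∈X , v∈Y))) ,
  (λ Y → reaching-tight D π M covering tight-X v∈X) ,
  (λ Y → goodReaching-dominated π M)
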